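{- Let $R$ be an order on $H$ and $Q$ an order on $N$, and suppose that the distinct sizes $h_1,\dots,h_u$ of the indifference classes of $R$ satisfy $\gcd(h_1,\dots,h_u)=1$. Then every decisive, $R$-anonymous and $Q$-neutral social preference correspondence admits an $R$-anonymous and $Q$-neutral resolute refinement; and, for every $k\in\{1,\dots,n-1\}$, every decisive, $R$-anonymous and $Q$-neutral $k$-multiwinner social choice correspondence admits an $R$-anonymous and $Q$-neutral resolute refinement.
   Context: Let $n,h\ge 2$ be integers, $N=\{1,\dots,n\}$, $H=\{1,\dots,h\}$. An order is a complete and transitive relation; its indifference classes are the equivalence classes of $\{(x,y):(x,y)\in R,(y,x)\in R\}$. $S_m$ is the symmetric group on $\{1,\dots,m\}$ with product $(\sigma\tau)(x)=\sigma(\tau(x))$. $\mathbf L(N)$ is the set of linear orders on $N$; a linear order $q$ with $q(1)\succ\dots\succ q(n)$ is identified with the permutation $r\mapsto q(r)$ in $S_n$. Let $\rho_0(r)=n-r+1$, $\Omega=\{id,\rho_0\}\le S_n$. $\mathcal P=\mathbf L(N)^h$. $G=S_h\times S_n\times\Omega$; $p^{(\varphi,\psi,\rho)}$ is the profile with $i$-th component $\psi p_{\varphi^{ -1}(i)}\rho$. A social preference correspondence assigns to each $p$ a subset $C(p)\subseteq\mathbf L(N)$; a $k$-multiwinner social choice correspondence assigns to each $p$ a set $C(p)$ of $k$-subsets of $N$. Decisive: $C(p)\ne\emptyset$ always; resolute: $|C(p)|=1$ always; $C'$ refines $C$ if $C'(p)\subseteq C(p)$ for all $p$. For $\psi\in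 S_n$, $\psi X=\{\psi q:q\in X\}$ for sets of linear orders and $\psi\mathbb W=\{\psi(W):W\in\mathbb W\}$ for families of subsets. For $U\le G$, $C$ is $U$-consistent if for all $p$ and $(\varphi,\psi,\rho)\in U$: $C(p^{(\varphi,\psi,\rho)})=\psi C(p)$ if $\rho=id$, and $C(p^{(\varphi,\psi,\rho)})\ne\psi C(p)$ if $\rho=\rho_0$ and $|C(p)|=1$. For a relation $R\subseteq\{1,\dots,m\}^2$, $\mathrm{Aut}(R)=\{\sigma\in S_m:\forall x,y,\ (\sigma(x),\sigma(y))\in R\iff(x,y)\in R\}$. $C$ is $R$-anonymous if $\mathrm{Aut}(R)\times\{id\}\times\{id\}$-consistent and $Q$-neutral if $\{id\}\times\mathrm{Aut}(Q)\times\{id\}$-consistent. -}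

module Defs where

open import Data.Nat using (ℕ; zero; suc)
open import Data.Nat.GCD using (gcd)
open import Data.Bool using (Bool; true; false; T; _∧_)
open import Data.Fin using (Fin; opposite)
open import Data.Fin.Properties using (opposite-involutive)
open import Data.Fin.Permutation using (Permutation′; _⟨$⟩ʳ_; _⟨$⟩ˡ_; inverseˡ)
open import Data.Fin.Subset using (Subset; ∣_∣; _∈_)
open import Data.Vec using (Vec; lookup; tabulate)
open import Data.Vec.Properties using (lookup∘tabulate)
open import Data.List using (List; foldr; map; allFin; deduplicate)
import Data.Nat.Properties as ℕP
open import Data.Product using (Σ; ∃; _×_; _,_)
open import Data.Sum using (_⊎_)
open import Function.Bundles using (_⇔_)
open import Relation.Nullary using (¬_)
open import Relation.Binary.PropositionalEquality
  using (_≡_; refl; sym; trans; cong)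

BRel : ℕ → Set
BRel m = Fin m → Fin m → Bool

IsOrder : ∀ {m} → BRel m → Set
IsOrder {m} R =
  (∀ x y → T (R x y) ⊎ T (R y x)) ×
  (∀ x y z → T (R x y) → T (R y z) → T (R x z))

IsAut : ∀ {m} → BRel m → Permutation′ m → Set
IsAut R σ = ∀ x y → R (σ ⟨$⟩ʳ x) (σ ⟨$⟩ʳ y) ≡ R x y

indiffClass : ∀ {m} → BRel m → Fin m → Subset m
indiffClass R x = tabulate (λ y → R x y ∧ R y x)

classSize : ∀ {m} → BRel m → Fin m → ℕ
classSize R x = ∣ indiffClass R x ∣

distinctClassSizes : ∀ {m} → BRel m → List ℕ
distinctClassSizes {m} R = deduplicate ℕP._≟_ (map (classSize R) (allFin m))

-- gcd of a list of naturals (gcd of the empty list is 0).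
gcdList : List ℕ → ℕ
gcdList = foldr gcd 0

-- A linear order q with q(1) ≻ … ≻ q(n) is
-- stored as the vector [q(1),…,q(n)] of pairwise distinct entries; the
-- associated permutation in S_n is r ↦ lookup (vec q) r.

record LinOrd (n : ℕ) : Set where
  constructor mkLin
  field
    vec : Vec (Fin n) n
    .distinct : ∀ i j → lookup vec i ≡ lookup vec j → i ≡ j
open LinOrd public

-- Ω = {id, ρ₀} with ρ₀(r) = n − r + 1.
data Ω : Set where
  idΩ ρ₀ : Ω

⟦_⟧Ω : ∀ {n} → Ω → Fin n → Fin n
⟦ idΩ ⟧Ω r = r
⟦ ρ₀ ⟧Ω r = opposite r

private
  ⟦⟧Ω-inj : ∀ {n} (ρ : Ω) (i j : Fin n) → ⟦ ρ ⟧Ω i ≡ ⟦ ρ ⟧Ω j → i ≡ j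
  ⟦⟧Ω-inj idΩ i j e = e
  ⟦⟧Ω-inj ρ₀ i j e =
    trans (sym (opposite-involutive i))
          (trans (cong opposite e) (opposite-involutive j))

actLin : ∀ {n} → Permutation′ n → LinOrd n → Ω → LinOrd n
actLin {n} ψ (mkLin v d) ρ = mkLin (tabulate f) (λ i j e →
    ⟦⟧Ω-inj ρ i j (d _ _
      (trans (sym (inverseˡ ψ))
        (trans (cong (ψ ⟨$⟩ˡ_)
          (trans (sym (lookup∘tabulate f i)) (trans e (lookup∘tabulate f j))))
          (inverseˡ ψ)))))
  where
  f : Fin n → Fin n
  f r = ψ ⟨$⟩ʳ lookup v (⟦ ρ ⟧Ω r)

Profile : ℕ → ℕ → Set
Profile n h = Vec (LinOrd n) h

actProfile : ∀ {n h} → Profile n h → Permutation′ h → Permutation′ n → Ω → Profile n h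
actProfile p φ ψ ρ = tabulate (λ i → actLin ψ (lookup p (φ ⟨$⟩ˡ i)) ρ)

record KSubset (n k : ℕ) : Set where
  constructor mkKSub
  field
    set : Subset n
    .card : ∣ set ∣ ≡ k
open KSubset public

-- Generic notions for correspondences whose values are (decidable) sets
-- of elements of A, where S_n acts on A; `Img ψ a b` means b = ψ a.

IsIdPerm : ∀ {m} → Permutation′ m → Set
IsIdPerm σ = ∀ x → σ ⟨$⟩ʳ x ≡ x

module Generic (n h : ℕ) (A : Set) (Img : Permutation′ n → A → A → Set) where

  SetA : Set
  SetA = A → Bool

  Corr : Set
  Corr = Profile n h → SetA

  IsImage : Permutation′ n → SetA → SetA → Set
  IsImage ψ X Y = ∀ b → T (Y b) ⇔ (∃ λ a → T (X a) × Img ψ a b)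

  Singleton : SetA → Set
  Singleton X = ∃ λ a → T (X a) × (∀ b → T (X b) → b ≡ a)

  ConsClause : Ω → Permutation′ n → SetA → SetA → Set
  ConsClause idΩ ψ X Y = IsImage ψ X Y
  ConsClause ρ₀  ψ X Y = Singleton X → ¬ IsImage ψ X Y

  -- U-consistency for U ≤ G given as a predicate on G = S_h × S_n × Ω.
  Consistent : (Permutation′ h → Permutation′ n → Ω → Set) → Corr → Set
  Consistent U C = ∀ p φ ψ ρ → U φ ψ ρ →
    ConsClause ρ ψ (C p) (C (actProfile p φ ψ ρ))

  Anonymous : BRel h → Corr → Set
  Anonymous R = Consistent (λ φ ψ ρ → IsAut R φ × IsIdPerm ψ × ρ ≡ idΩ)

  Neutral : BRel n → Corr → Set
  Neutral Q = Consistent (λ φ ψ ρ → IsIdPerm φ × IsAut Q ψ × ρ ≡ idΩ)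

  Decisive : Corr → Set
  Decisive C = ∀ p → ∃ λ a → T (C p a)

  Resolute : Corr → Set
  Resolute C = ∀ p → Singleton (C p)

  Refines : Corr → Corr → Set
  Refines C′ C = ∀ p a → T (C′ p a) → T (C p a)

  AdmitsResoluteRefinements : BRel h → BRel n → Set
  AdmitsResoluteRefinements R Q =
    ∀ (C : Corr) → Decisive C → Anonymous R C → Neutral Q C →
    Σ Corr λ C′ → Resolute C′ × Refines C′ C × Anonymous R C′ × Neutral Q C′

ImgLin : ∀ {n} → Permutation′ n → LinOrd n → LinOrd n → Set
ImgLin ψ q q′ = q′ ≡ actLin ψ q idΩ

ImgKSub : ∀ {n k} → Permutation′ n → KSubset n k → KSubset n k → Set
ImgKSub ψ W W′ = ∀ x → (x ∈ set W′) ⇔ (∃ λ y → y ∈ set W × ψ ⟨$⟩ʳ y ≡ x)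

module SPC (n h : ℕ) = Generic n h (LinOrd n) ImgLin
module MW (n h k : ℕ) = Generic n h (KSubset n k) ImgKSub

module Submission where

-- The group G = Aut(R) × Aut(Q) acts on profiles by p ↦ p^(φ,ψ,id), and the
-- proof has two parts.
--
-- Suppose (φ, ψ) ∈ G fixes a profile p.
--    Take a ψ-orbit O and an indifference class X of R, and sort the voters
--    of X by the first alternative of O in their ranking.  An automorphism of
--    an order preserves its classes, so φ permutes X, and it carries the voters
--    sorted under y to those sorted under ψ(y); hence all |O| groups have the
--    same size and |O| divides |X|.  The gcd hypothesis forces |O| = 1, i.e.
--    ψ is the identity.
--
-- Profiles and G are finite, so every
--    G-orbit has a canonical representative p₀ (the first one in a fixed
--    enumeration); fix a₀ ∈ C(p₀).  If g ⊙ p = p₀ put C′(p) = {ψ_g⁻¹(a₀)}.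
--    By freeness ψ_g is determined by p, which makes C′ well defined and
--    equivariant under G, hence R-anonymous and Q-neutral; consistency of C
--    gives C′ ⊆ C.

open import Defs
open import Data.Nat using (ℕ; zero; suc; _+_; _*_; _≤_; _<_)
import Data.Nat.Properties as ℕP
open import Data.Nat.Divisibility using (_∣_; divides; _∣0; ∣1⇒≡1)
open import Data.Nat.GCD using (gcd-greatest)
open import Data.Nat.GeneralisedArithmetic using (fold; fold-+)
open import Data.Bool using (Bool; true; false; _∧_; T)
import Data.Bool as Bool
import Data.Bool.Properties as BoolP
open import Data.Fin using (Fin; zero; suc; toℕ; fromℕ; lower₁; inject₁; punchOut; punchIn)
import Data.Fin.Properties as FinP
open import Data.Fin.Subset using (Subset; ∣_∣; _∈_)
open import Data.Fin.Subset.Properties using (p⊂q⇒∣p∣<∣q∣; ∣⁅x⁆∣≡1; x∈⁅y⁆⇒x≡y; ⊆-antisym)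
open import Data.Fin.Permutation as Perm
  using (Permutation′; _⟨$⟩ʳ_; _⟨$⟩ˡ_; inverseˡ; inverseʳ; flip; _∘ₚ_; insert; remove; insert-remove; insert-punchIn)
open import Data.Vec using (Vec; []; _∷_; lookup; tabulate)
open import Data.Vec.Properties using (lookup∘tabulate; tabulate∘lookup; tabulate-cong; lookup⇒[]=; []=⇒lookup)
import Data.Vec.Properties as VecP
open import Data.List using (List; []; _∷_; allFin; cartesianProductWith; cartesianProduct; mapMaybe)
open import Data.List.Relation.Unary.All using (All; []; _∷_)
import Data.List.Relation.Unary.All.Properties as AllP
open import Data.List.Relation.Unary.Any as Any using (Any; here)
import Data.List.Relation.Unary.Any.Properties as AnyP
open import Data.List.Membership.Propositional using (lose) renaming (_∈_ to _∈ₗ_)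
open import Data.List.Membership.Propositional.Properties using (∈-allFin; ∈-cartesianProductWith⁺; ∈-cartesianProduct⁺)
open import Data.Maybe using (Maybe; just; nothing)
import Data.Maybe.Relation.Unary.Any as MaybeAny
open import Data.Product using (∃; _×_; _,_; proj₁; proj₂)
open import Data.Sum using (_⊎_; inj₁; inj₂; [_,_]′)
import Data.Sum
open import Data.Empty using (⊥; ⊥-elim)
import Data.Empty.Irrelevant as Irrelevant
open import Function using (_∘_; id; _⟨_⟩_)
open import Function.Bundles using (_⇔_; mk⇔; Equivalence)
open import Relation.Nullary using (¬_; Dec; yes; no; does; contradiction)
open import Relation.Nullary.Decidable using (dec-true; dec-false; does-⇔; map′; _×-dec_; _→-dec_)
open import Relation.Unary using (Pred; Decidable)
open import Relation.Binary.Definitions using (DecidableEquality)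
open import Relation.Binary.PropositionalEquality
open import Algebra.Properties.Semiring.Sum ℕP.+-*-semiring
  using (sum; sum-cong-≗; sum-permute; ∑-comm; sum-replicate-zero; *-distribˡ-sum; *-distribʳ-sum)

ι : Bool → ℕ
ι false = 0
ι true  = 1

bool-ext : ∀ {a b : Bool} → (a ≡ true → b ≡ true) → (b ≡ true → a ≡ true) → a ≡ b
bool-ext f g = BoolP.⇔→≡ (mk⇔ f g)

T⇒≡ : ∀ {b} → T b → b ≡ true
T⇒≡ = Equivalence.to BoolP.T-≡

≡⇒T : ∀ {b} → b ≡ true → T b
≡⇒T = Equivalence.from BoolP.T-≡

false≢true : false ≢ true
false≢true ()

≡⇒⇔ : ∀ {a b : Bool} → a ≡ b → (a ≡ true ⇔ b ≡ true)
≡⇒⇔ a≡b = mk⇔ (trans (sym a≡b)) (trans a≡b)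

does-true : ∀ {p} {P : Set p} (P? : Dec P) → does P? ≡ true → P
does-true (yes p) _ = p

∈-tabulate⁺ : ∀ {m} {F : Fin m → Bool} {x} → F x ≡ true → x ∈ tabulate F
∈-tabulate⁺ {F = F} {x} Fx = lookup⇒[]= x (tabulate F) (trans (lookup∘tabulate F x) Fx)

∈-tabulate⁻ : ∀ {m} {F : Fin m → Bool} {x} → x ∈ tabulate F → F x ≡ true
∈-tabulate⁻ {F = F} {x} x∈ = trans (sym (lookup∘tabulate F x)) ([]=⇒lookup x∈)

∣tabulate∣ : ∀ {m} (F : Fin m → Bool) → ∣ tabulate F ∣ ≡ sum (λ i → ι (F i))
∣tabulate∣ {zero}  F = refl
∣tabulate∣ {suc m} F with F zero
... | true  = cong suc (∣tabulate∣ (λ i → F (suc i)))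
... | false = ∣tabulate∣ (λ i → F (suc i))

∣tabulate∘π∣ : ∀ {m} (π : Permutation′ m) (F : Fin m → Bool) →
               ∣ tabulate (λ i → F (π ⟨$⟩ʳ i)) ∣ ≡ ∣ tabulate F ∣
∣tabulate∘π∣ π F = begin
  ∣ tabulate (λ i → F (π ⟨$⟩ʳ i)) ∣  ≡⟨ ∣tabulate∣ (λ i → F (π ⟨$⟩ʳ i)) ⟩
  sum (λ i → ι (F (π ⟨$⟩ʳ i)))       ≡⟨ sum-permute (λ i → ι (F i)) π ⟨
  sum (λ i → ι (F i))                ≡⟨ ∣tabulate∣ F ⟨
  ∣ tabulate F ∣                     ∎
  where open ≡-Reasoning

count-point : ∀ {m} (x : Fin m) → sum (λ y → ι (does (x FinP.≟ y))) ≡ 1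
count-point {suc m} zero    = cong suc (sum-replicate-zero m)
count-point {suc m} (suc x) = count-point x

two-points : ∀ {m} {O : Subset m} {x y} → x ∈ O → y ∈ O → y ≢ x → 1 < ∣ O ∣
two-points {O = O} {x} {y} x∈O y∈O y≢x = subst (_< ∣ O ∣) (∣⁅x⁆∣≡1 x)
  (p⊂q⇒∣p∣<∣q∣ ((λ z∈ → subst (_∈ O) (sym (x∈⁅y⁆⇒x≡y x z∈)) x∈O) ,
                y , y∈O , λ y∈ → y≢x (x∈⁅y⁆⇒x≡y x y∈)))

-- An injective endomap of Fin m is surjective.  The injectivity proof may be
-- irrelevant (as for linear orders), since the preimage is found by search.
missing-value : ∀ {m} (f : Fin m → Fin m) → (∀ {x y} → f x ≡ f y → x ≡ y) →
                ∀ y → ¬ (∃ λ x → f x ≡ y) → ⊥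
missing-value {suc m} f f-inj y miss = ℕP.<-irrefl refl (FinP.injective⇒≤ f′-inj)
  where
  -- f with the missing value y punched out, an injection Fin (suc m) → Fin m
  f′ : Fin (suc m) → Fin m
  f′ x = punchOut {i = y} {j = f x} (λ y≡fx → miss (x , sym y≡fx))
  f′-inj : ∀ {x x′} → f′ x ≡ f′ x′ → x ≡ x′
  f′-inj {x} {x′} = f-inj ∘ FinP.punchOut-injective (λ e → miss (x , sym e)) (λ e → miss (x′ , sym e))

injective⇒surjective : ∀ {m} (f : Fin m → Fin m) → .(∀ {x y} → f x ≡ f y → x ≡ y) →
                       ∀ y → ∃ λ x → f x ≡ y
injective⇒surjective f f-inj y with FinP.any? (λ x → f x FinP.≟ y)
... | yes hit  = hit
... | no  miss = Irrelevant.⊥-elim (missing-value f f-inj y miss)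

-- It depends only on the predicate up to logical equivalence,
-- which is what makes choices made through it invariant.
module _ {A : Set} where

  first : ∀ {ℓ} {P : Pred A ℓ} → Decidable P → (xs : List A) → Any P xs → A
  first P? (x ∷ xs) hit with P? x
  ... | yes _   = x
  ... | no ¬Px = first P? xs (Any.tail ¬Px hit)

  first-satisfies : ∀ {ℓ} {P : Pred A ℓ} (P? : Decidable P) xs (hit : Any P xs) →
                    P (first P? xs hit)
  first-satisfies P? (x ∷ xs) hit with P? x
  ... | yes Px  = Px
  ... | no ¬Px = first-satisfies P? xs (Any.tail ¬Px hit)

  first-cong : ∀ {ℓ ℓ′} {P : Pred A ℓ} {Q : Pred A ℓ′} (P? : Decidable P) (Q? : Decidable Q) →
               (∀ x → P x ⇔ Q x) → ∀ xs (hitP : Any P xs) (hitQ : Any Q xs) →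
               first P? xs hitP ≡ first Q? xs hitQ
  first-cong P? Q? P⇔Q (x ∷ xs) hitP hitQ with P? x | Q? x
  ... | yes _   | yes _   = refl
  ... | yes Px  | no ¬Qx = contradiction (Equivalence.to (P⇔Q x) Px) ¬Qx
  ... | no ¬Px | yes Qx  = contradiction (Equivalence.from (P⇔Q x) Qx) ¬Px
  ... | no ¬Px | no ¬Qx = first-cong P? Q? P⇔Q xs (Any.tail ¬Px hitP) (Any.tail ¬Qx hitQ)

∣gcdList : ∀ {d} (xs : List ℕ) → All (d ∣_) xs → d ∣ gcdList xs
∣gcdList []       []         = _ ∣0
∣gcdList (x ∷ xs) (d∣x ∷ d∣xs) = gcd-greatest d∣x (∣gcdList xs d∣xs)

common-divisor-of-class-sizes : ∀ {h} (R : BRel h) → gcdList (distinctClassSizes R) ≡ 1 →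
                                ∀ {d} → (∀ x → d ∣ classSize R x) → d ≡ 1
common-divisor-of-class-sizes {h} R gcd≡1 d∣sizes = ∣1⇒≡1 (subst (_ ∣_) gcd≡1
  (∣gcdList _ (AllP.deduplicate⁺ ℕP._≟_ (AllP.map⁺ (AllP.tabulate⁺ d∣sizes)))))

module Order {m} (R : BRel m) (R-order : IsOrder R) where

  complete : ∀ x y → R x y ≡ true ⊎ R y x ≡ true
  complete x y = Data.Sum.map T⇒≡ T⇒≡ (proj₁ R-order x y)

  reflexive : ∀ x → R x x ≡ true
  reflexive x = [ id , id ]′ (complete x x)

  transitive : ∀ {x y z} → R x y ≡ true → R y z ≡ true → R x z ≡ true
  transitive {x} {y} {z} Rxy Ryz = T⇒≡ (proj₂ R-order x y z (≡⇒T Rxy) (≡⇒T Ryz))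

  indifferent-left : ∀ {x x′} → R x x′ ≡ true → R x′ x ≡ true → ∀ y → R x y ≡ R x′ y
  indifferent-left Rxx′ Rx′x y = bool-ext (transitive Rx′x) (transitive Rxx′)

  indifferent-right : ∀ {x x′} → R x x′ ≡ true → R x′ x ≡ true → ∀ y → R y x ≡ R y x′
  indifferent-right Rxx′ Rx′x y = bool-ext (λ Ryx → transitive Ryx Rxx′) (λ Ryx′ → transitive Ryx′ Rx′x)

  upper : Fin m → Subset m
  upper z = tabulate (λ y → R y z)

  upper-strict : ∀ {x z} → R x z ≡ true → R z x ≡ false → ∣ upper x ∣ < ∣ upper z ∣
  upper-strict {x} {z} Rxz Rzx≡false = p⊂q⇒∣p∣<∣q∣
    ( (λ y∈ → ∈-tabulate⁺ (transitive (∈-tabulate⁻ y∈) Rxz))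
    , z , ∈-tabulate⁺ (reflexive z) , λ z∈ → false≢true (trans (sym Rzx≡false) (∈-tabulate⁻ z∈)))

  module Automorphism (τ : Permutation′ m) (τ-aut : IsAut R τ) where

    upper-size-invariant : ∀ z → ∣ upper (τ ⟨$⟩ʳ z) ∣ ≡ ∣ upper z ∣
    upper-size-invariant z = begin
      ∣ upper (τ ⟨$⟩ʳ z) ∣                               ≡⟨ ∣tabulate∘π∣ τ (λ y → R y (τ ⟨$⟩ʳ z)) ⟨
      ∣ tabulate (λ y → R (τ ⟨$⟩ʳ y) (τ ⟨$⟩ʳ z)) ∣      ≡⟨ cong ∣_∣ (tabulate-cong (λ y → τ-aut y z)) ⟩
      ∣ upper z ∣                                        ∎
      where open ≡-Reasoning

    indifferent-to-image : ∀ x → R x (τ ⟨$⟩ʳ x) ≡ true × R (τ ⟨$⟩ʳ x) x ≡ true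
    indifferent-to-image x with R x (τ ⟨$⟩ʳ x) in Rxτx | R (τ ⟨$⟩ʳ x) x in Rτxx
    ... | true  | true  = refl , refl
    ... | true  | false = ⊥-elim (ℕP.<-irrefl (sym (upper-size-invariant x)) (upper-strict Rxτx Rτxx))
    ... | false | true  = ⊥-elim (ℕP.<-irrefl (upper-size-invariant x) (upper-strict Rτxx Rxτx))
    ... | false | false with complete x (τ ⟨$⟩ʳ x)
    ...   | inj₁ Rxτx′ = ⊥-elim (false≢true (trans (sym Rxτx) Rxτx′))
    ...   | inj₂ Rτxx′ = ⊥-elim (false≢true (trans (sym Rτxx) Rτxx′))

    class-invariant : ∀ x i → R x (τ ⟨$⟩ʳ i) ∧ R (τ ⟨$⟩ʳ i) x ≡ R x i ∧ R i x
    class-invariant x i = begin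
      R x (τ ⟨$⟩ʳ i) ∧ R (τ ⟨$⟩ʳ i) x                ≡⟨ cong₂ _∧_ (indifferent-left Rxτx Rτxx _) (indifferent-right Rxτx Rτxx _) ⟩
      R (τ ⟨$⟩ʳ x) (τ ⟨$⟩ʳ i) ∧ R (τ ⟨$⟩ʳ i) (τ ⟨$⟩ʳ x) ≡⟨ cong₂ _∧_ (τ-aut x i) (τ-aut i x) ⟩
      R x i ∧ R i x                                  ∎
      where
      open ≡-Reasoning
      Rxτx = proj₁ (indifferent-to-image x)
      Rτxx = proj₂ (indifferent-to-image x)

fold-injective : ∀ {m} (f : Fin m → Fin m) → (∀ {x y} → f x ≡ f y → x ≡ y) →
                 ∀ k {x y} → fold x f k ≡ fold y f k → x ≡ y
fold-injective f f-inj zero    e = e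
fold-injective f f-inj (suc k) e = fold-injective f f-inj k (f-inj e)

module Orbit {n} (ψ : Permutation′ n) (a : Fin n) where

  ψ-injective : ∀ {x y} → ψ ⟨$⟩ʳ x ≡ ψ ⟨$⟩ʳ y → x ≡ y
  ψ-injective {x} {y} e = trans (sym (inverseˡ ψ)) (trans (cong (ψ ⟨$⟩ˡ_) e) (inverseˡ ψ))

  iter : ℕ → Fin n
  iter = fold a (ψ ⟨$⟩ʳ_)

  -- Among a, ψ(a), …, ψⁿ(a) two points coincide, so a returns to itself.
  returns : ∃ λ m → iter (suc m) ≡ a
  returns with i , j , i<j , iterᵢ≡iterⱼ ← FinP.pigeonhole (ℕP.n<1+n n) (iter ∘ toℕ)
    with o , i+1+o≡j ← ℕP.m≤n⇒∃[o]m+o≡n i<j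
    = o , sym (fold-injective _ ψ-injective (toℕ i) (begin
      iter (toℕ i)                   ≡⟨ iterᵢ≡iterⱼ ⟩
      iter (toℕ j)                   ≡⟨ cong iter (trans (sym i+1+o≡j) (sym (ℕP.+-suc (toℕ i) o))) ⟩
      iter (toℕ i + suc o)           ≡⟨ fold-+ a (ψ ⟨$⟩ʳ_) (toℕ i) ⟩
      fold (iter (suc o)) (ψ ⟨$⟩ʳ_) (toℕ i) ∎))
    where open ≡-Reasoning

  -- a = ψ^(1 + period-1)(a); the orbit is {ψᵏ(a) : k ≤ period-1}.
  period-1 : ℕ
  period-1 = proj₁ returns

  InOrbit : Fin n → Set
  InOrbit y = ∃ λ (k : Fin (suc period-1)) → iter (toℕ k) ≡ y

  inOrbit? : ∀ y → Dec (InOrbit y)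
  inOrbit? y = FinP.any? (λ k → iter (toℕ k) FinP.≟ y)

  inOrbit : Fin n → Bool
  inOrbit y = does (inOrbit? y)

  orbit : Subset n
  orbit = tabulate inOrbit

  a∈orbit : inOrbit a ≡ true
  a∈orbit = dec-true (inOrbit? a) (zero , refl)

  InOrbit-ψ⁺ : ∀ y → InOrbit y → InOrbit (ψ ⟨$⟩ʳ y)
  InOrbit-ψ⁺ y (k , iterₖ≡y) with period-1 ℕP.≟ toℕ k
  ... | yes last = zero , sym (begin
    ψ ⟨$⟩ʳ y               ≡⟨ cong (ψ ⟨$⟩ʳ_) (sym iterₖ≡y) ⟩
    iter (suc (toℕ k))     ≡⟨ cong (iter ∘ suc) (sym last) ⟩
    iter (suc period-1)    ≡⟨ proj₂ returns ⟩
    a                      ∎)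
    where open ≡-Reasoning
  ... | no ¬last = suc (lower₁ k ¬last) ,
    trans (cong (iter ∘ suc) (FinP.toℕ-lower₁ k ¬last)) (cong (ψ ⟨$⟩ʳ_) iterₖ≡y)

  InOrbit-ψ⁻ : ∀ y → InOrbit (ψ ⟨$⟩ʳ y) → InOrbit y
  InOrbit-ψ⁻ y (zero , a≡ψy) = fromℕ period-1 ,
    ψ-injective (trans (cong (iter ∘ suc) (FinP.toℕ-fromℕ period-1)) (trans (proj₂ returns) a≡ψy))
  InOrbit-ψ⁻ y (suc k , iterₖ₊₁≡ψy) =
    inject₁ k , ψ-injective (trans (cong (iter ∘ suc) (FinP.toℕ-inject₁ k)) iterₖ₊₁≡ψy)

  inOrbit-ψ : ∀ y → inOrbit (ψ ⟨$⟩ʳ y) ≡ inOrbit y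
  inOrbit-ψ y = does-⇔ (mk⇔ (InOrbit-ψ⁻ y) (InOrbit-ψ⁺ y)) (inOrbit? (ψ ⟨$⟩ʳ y)) (inOrbit? y)

  constant-on-orbit : (c : Fin n → ℕ) → (∀ y → c (ψ ⟨$⟩ʳ y) ≡ c y) →
                      ∀ y → inOrbit y ≡ true → c y ≡ c a
  constant-on-orbit c c-inv y y∈ with k , iterₖ≡y ← does-true (inOrbit? y) y∈ =
    trans (cong c (sym iterₖ≡y)) (along (toℕ k))
    where
    along : ∀ k → c (iter k) ≡ c a
    along zero    = refl
    along (suc k) = trans (c-inv (iter k)) (along k)

-- Let τ ∈ Aut(R) and ψ ∈ Sₙ, and let
-- P j (j ∈ H) be surjections of N with P (τ j) = ψ ∘ P j.  Then the size of
-- every ψ-orbit divides the size of every indifference class of R: in a class,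
-- the voters j whose first entry P j r lying in the orbit equals y are equally
-- many for all y in the orbit, since τ permutes the class and moves y to ψ y.
module Regularity {n h} (R : BRel h) (R-order : IsOrder R)
  (τ : Permutation′ h) (τ-aut : IsAut R τ) (ψ : Permutation′ n)
  (P : Fin h → Fin n → Fin n) (P-onto : ∀ j y → ∃ λ r → P j r ≡ y)
  (P-equivariant : ∀ j r → P (τ ⟨$⟩ʳ j) r ≡ ψ ⟨$⟩ʳ P j r) where

  open Order.Automorphism R R-order τ τ-aut using (class-invariant)

  module _ (a : Fin n) where
    open Orbit ψ a

    InOrbitAt : Fin h → Fin n → Set
    InOrbitAt j r = inOrbit (P j r) ≡ true

    inOrbitAt? : ∀ j → Decidable (InOrbitAt j)
    inOrbitAt? j r = inOrbit (P j r) Bool.≟ true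

    hits : ∀ j → Any (InOrbitAt j) (allFin n)
    hits j with r , Pjr≡a ← P-onto j a = lose (∈-allFin r) (trans (cong inOrbit Pjr≡a) a∈orbit)

    position : Fin h → Fin n
    position j = first (inOrbitAt? j) (allFin n) (hits j)

    entry : Fin h → Fin n
    entry j = P j (position j)

    entry-in-orbit : ∀ j → inOrbit (entry j) ≡ true
    entry-in-orbit j = first-satisfies (inOrbitAt? j) (allFin n) (hits j)

    -- Since the orbit is ψ-invariant, P (τ j) = ψ ∘ P j meets it at the same position.
    entry-equivariant : ∀ j → entry (τ ⟨$⟩ʳ j) ≡ ψ ⟨$⟩ʳ entry j
    entry-equivariant j = trans (cong (P (τ ⟨$⟩ʳ j)) same-position) (P-equivariant j (position j))
      where
      same-position : position (τ ⟨$⟩ʳ j) ≡ position j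
      same-position = first-cong (inOrbitAt? (τ ⟨$⟩ʳ j)) (inOrbitAt? j)
        (λ r → ≡⇒⇔ (trans (cong inOrbit (P-equivariant j r)) (inOrbit-ψ (P j r))))
        (allFin n) (hits (τ ⟨$⟩ʳ j)) (hits j)

    module _ (x : Fin h) where

      member : Fin h → Bool
      member i = R x i ∧ R i x

      fibre : Fin n → ℕ
      fibre y = sum (λ i → ι (member i) * ι (does (entry i FinP.≟ y)))

      -- τ permutes the class and turns entry y into entry ψ y.
      fibre-ψ : ∀ y → fibre (ψ ⟨$⟩ʳ y) ≡ fibre y
      fibre-ψ y = trans (sum-permute _ τ) (sum-cong-≗ λ i →
        cong₂ (λ b c → ι b * ι c) (class-invariant x i)
          (trans (cong (λ z → does (z FinP.≟ ψ ⟨$⟩ʳ y)) (entry-equivariant i))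
                 (does-⇔ (mk⇔ ψ-injective (cong (ψ ⟨$⟩ʳ_))) (_ FinP.≟ _) (_ FinP.≟ _))))

      -- All entries lie in the orbit, so fibres are empty outside it
      -- and, by fibre-ψ, all of the same size inside it.
      fibre-outside : ∀ y → inOrbit y ≡ false → fibre y ≡ 0
      fibre-outside y y∉ = trans (sum-cong-≗ λ i →
        trans (cong (λ b → ι (member i) * ι b) (dec-false (entry i FinP.≟ y) λ entry≡y →
                 false≢true (trans (sym y∉) (subst (λ z → inOrbit z ≡ true) entry≡y (entry-in-orbit i)))))
              (ℕP.*-zeroʳ (ι (member i))))
        (sum-replicate-zero h)

      fibre-by-orbit : ∀ y → fibre y ≡ ι (inOrbit y) * fibre a
      fibre-by-orbit y with inOrbit y in y∈
      ... | true  = trans (constant-on-orbit fibre fibre-ψ y y∈) (sym (ℕP.+-identityʳ (fibre a)))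
      ... | false = fibre-outside y y∈

      -- Counting the class by the entries of its members.
      class-size : classSize R x ≡ ∣ orbit ∣ * fibre a
      class-size = begin
        classSize R x                                        ≡⟨ ∣tabulate∣ member ⟩
        sum (λ i → ι (member i))                             ≡⟨ sum-cong-≗ (λ i → cong (ι (member i) *_) (count-point (entry i))
                                                                  ⟨ trans ⟩ ℕP.*-identityʳ _) ⟨
        sum (λ i → ι (member i) * sum (is-entry i))          ≡⟨ sum-cong-≗ (λ i → *-distribˡ-sum (ι (member i)) (is-entry i)) ⟩
        sum (λ i → sum (λ y → ι (member i) * is-entry i y))  ≡⟨ ∑-comm (λ i y → ι (member i) * is-entry i y) ⟩
        sum fibre                                            ≡⟨ sum-cong-≗ fibre-by-orbit ⟩
        sum (λ y → ι (inOrbit y) * fibre a)                  ≡⟨ *-distribʳ-sum (fibre a) (ι ∘ inOrbit) ⟨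
        sum (ι ∘ inOrbit) * fibre a                          ≡⟨ cong (_* fibre a) (∣tabulate∣ inOrbit) ⟨
        ∣ orbit ∣ * fibre a                                   ∎
        where
        open ≡-Reasoning
        is-entry : Fin h → Fin n → ℕ
        is-entry i y = ι (does (entry i FinP.≟ y))

    orbit-divides-class-sizes : ∀ x → ∣ orbit ∣ ∣ classSize R x
    orbit-divides-class-sizes x = divides (fibre x a) (trans (class-size x) (ℕP.*-comm ∣ orbit ∣ (fibre x a)))

  trivial : gcdList (distinctClassSizes R) ≡ 1 → ∀ a → ψ ⟨$⟩ʳ a ≡ a
  trivial gcd≡1 a with ψ ⟨$⟩ʳ a FinP.≟ a
  ... | yes ψa≡a = ψa≡a
  ... | no ψa≢a  = ⊥-elim (ℕP.<-irrefl (sym ∣orbit∣≡1)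
         (two-points (∈-tabulate⁺ a∈orbit) (∈-tabulate⁺ (trans (inOrbit-ψ a) a∈orbit)) ψa≢a))
    where
    open Orbit ψ a
    ∣orbit∣≡1 : ∣ orbit ∣ ≡ 1
    ∣orbit∣≡1 = common-divisor-of-class-sizes R gcd≡1 (orbit-divides-class-sizes a)

LinOrd-≡ : ∀ {n} {q q′ : LinOrd n} → vec q ≡ vec q′ → q ≡ q′
LinOrd-≡ refl = refl

_≟L_ : ∀ {n} → DecidableEquality (LinOrd n)
q ≟L q′ = map′ LinOrd-≡ (cong vec) (VecP.≡-dec FinP._≟_ (vec q) (vec q′))

_≟P_ : ∀ {n h} → DecidableEquality (Profile n h)
_≟P_ = VecP.≡-dec _≟L_

vec-ext : ∀ {A : Set} {m} {u v : Vec A m} → (∀ i → lookup u i ≡ lookup v i) → u ≡ v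
vec-ext {u = u} {v} u≗v = trans (sym (tabulate∘lookup u)) (trans (tabulate-cong u≗v) (tabulate∘lookup v))

rank : ∀ {n h} → Profile n h → Fin h → Fin n → Fin n
rank p j r = lookup (vec (lookup p j)) r

profile-ext : ∀ {n h} {p p′ : Profile n h} → (∀ j r → rank p j r ≡ rank p′ j r) → p ≡ p′
profile-ext p≗p′ = vec-ext (λ j → LinOrd-≡ (vec-ext (p≗p′ j)))

linOrd-onto : ∀ {n} (q : LinOrd n) y → ∃ λ r → lookup (vec q) r ≡ y
linOrd-onto (mkLin v v-distinct) = injective⇒surjective (lookup v) (λ {r} {r′} → v-distinct r r′)

rank-act : ∀ {n h} (p : Profile n h) φ ψ i r →
           rank (actProfile p φ ψ idΩ) i r ≡ ψ ⟨$⟩ʳ rank p (φ ⟨$⟩ˡ i) r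
rank-act p φ ψ i r = trans (cong (λ q → lookup (vec q) r) (lookup∘tabulate _ i)) (lookup∘tabulate _ r)

vectors : ∀ {A : Set} → List A → (m : ℕ) → List (Vec A m)
vectors xs zero    = [] ∷ []
vectors xs (suc m) = cartesianProductWith _∷_ xs (vectors xs m)

∈-vectors : ∀ {A : Set} {xs : List A} → (∀ x → x ∈ₗ xs) → ∀ {m} (v : Vec A m) → v ∈ₗ vectors xs m
∈-vectors all∈ []      = here refl
∈-vectors all∈ (x ∷ v) = ∈-cartesianProductWith⁺ _∷_ (all∈ x) (∈-vectors all∈ v)

Distinct : ∀ {n} → Vec (Fin n) n → Set
Distinct v = ∀ i j → lookup v i ≡ lookup v j → i ≡ j

distinct? : ∀ {n} (v : Vec (Fin n) n) → Dec (Distinct v)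
distinct? v = FinP.all? λ i → FinP.all? λ j → (lookup v i FinP.≟ lookup v j) →-dec (i FinP.≟ j)

toLinOrd : ∀ {n} → Vec (Fin n) n → Maybe (LinOrd n)
toLinOrd v with distinct? v
... | yes d = just (mkLin v d)
... | no  _ = nothing

linOrds : ∀ n → List (LinOrd n)
linOrds n = mapMaybe toLinOrd (vectors (allFin n) n)

∈-linOrds : ∀ {n} (q : LinOrd n) → q ∈ₗ linOrds n
∈-linOrds {n} (mkLin v d) = AnyP.mapMaybe⁺ toLinOrd _
  (AnyP.map⁺ (Any.map (λ v≡w → subst (MaybeAny.Any (mkLin v d ≡_) ∘ toLinOrd) v≡w converts)
                       (∈-vectors ∈-allFin v)))
  where
  converts : MaybeAny.Any (mkLin v d ≡_) (toLinOrd v)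
  converts with distinct? v
  ... | yes _  = MaybeAny.just refl
  ... | no ¬d = Irrelevant.⊥-elim (¬d d)

profiles : ∀ n h → List (Profile n h)
profiles n h = vectors (linOrds n) h

∈-profiles : ∀ {n h} (p : Profile n h) → p ∈ₗ profiles n h
∈-profiles = ∈-vectors ∈-linOrds

-- Every permutation agrees pointwise with one in the list, built by choosing the image of 0.
permutations : ∀ m → List (Permutation′ m)
permutations zero    = Perm.id ∷ []
permutations (suc m) = cartesianProductWith (insert zero) (allFin (suc m)) (permutations m)

∈-permutations : ∀ {m} (σ : Permutation′ m) → ∃ λ π → π ∈ₗ permutations m × σ Perm.≈ π
∈-permutations {zero}  σ = Perm.id , here refl , λ ()
∈-permutations {suc m} σ with π , π∈ , σ′≈π ← ∈-permutations (remove zero σ) =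
  insert zero (σ ⟨$⟩ʳ zero) π , ∈-cartesianProductWith⁺ (insert zero) (∈-allFin _) π∈ , agrees
  where
  agrees : σ Perm.≈ insert zero (σ ⟨$⟩ʳ zero) π
  agrees zero    = refl
  agrees (suc x) = begin
    σ ⟨$⟩ʳ suc x                                            ≡⟨ insert-remove zero σ (suc x) ⟨
    insert zero (σ ⟨$⟩ʳ zero) (remove zero σ) ⟨$⟩ʳ suc x    ≡⟨ insert-punchIn zero (σ ⟨$⟩ʳ zero) (remove zero σ) x ⟩
    punchIn (σ ⟨$⟩ʳ zero) (remove zero σ ⟨$⟩ʳ x)            ≡⟨ cong (punchIn (σ ⟨$⟩ʳ zero)) (σ′≈π x) ⟩
    punchIn (σ ⟨$⟩ʳ zero) (π ⟨$⟩ʳ x)                        ≡⟨ insert-punchIn zero (σ ⟨$⟩ʳ zero) π x ⟨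
    insert zero (σ ⟨$⟩ʳ zero) π ⟨$⟩ʳ suc x                  ∎
    where open ≡-Reasoning

≈-inverse : ∀ {m} {π ρ : Permutation′ m} → π Perm.≈ ρ → ∀ i → π ⟨$⟩ˡ i ≡ ρ ⟨$⟩ˡ i
≈-inverse {π = π} {ρ} π≈ρ i =
  trans (sym (inverseˡ ρ)) (cong (ρ ⟨$⟩ˡ_) (trans (sym (π≈ρ (π ⟨$⟩ˡ i))) (inverseʳ π)))

inverse-of-composite : ∀ {m} (ρ σ π : Permutation′ m) → (∀ x → ρ ⟨$⟩ʳ (σ ⟨$⟩ʳ x) ≡ π ⟨$⟩ʳ x) →
                       flip ρ Perm.≈ (flip π ∘ₚ σ)
inverse-of-composite ρ σ π ρσ≡π y = begin
  ρ ⟨$⟩ˡ y                              ≡⟨ cong (ρ ⟨$⟩ˡ_) (inverseʳ π) ⟨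
  ρ ⟨$⟩ˡ (π ⟨$⟩ʳ (π ⟨$⟩ˡ y))            ≡⟨ cong (ρ ⟨$⟩ˡ_) (ρσ≡π (π ⟨$⟩ˡ y)) ⟨
  ρ ⟨$⟩ˡ (ρ ⟨$⟩ʳ (σ ⟨$⟩ʳ (π ⟨$⟩ˡ y)))   ≡⟨ inverseˡ ρ ⟩
  σ ⟨$⟩ʳ (π ⟨$⟩ˡ y)                     ∎
  where open ≡-Reasoning

module _ {n h} (p : Profile n h) where

  actProfile-cong : ∀ φ φ′ ψ ψ′ → φ Perm.≈ φ′ → ψ Perm.≈ ψ′ →
                    actProfile p φ ψ idΩ ≡ actProfile p φ′ ψ′ idΩ
  actProfile-cong φ φ′ ψ ψ′ φ≈φ′ ψ≈ψ′ = profile-ext λ i r → begin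
    rank (actProfile p φ ψ idΩ) i r     ≡⟨ rank-act p φ ψ i r ⟩
    ψ ⟨$⟩ʳ rank p (φ ⟨$⟩ˡ i) r          ≡⟨ cong (λ j → ψ ⟨$⟩ʳ rank p j r) (≈-inverse {π = φ} {φ′} φ≈φ′ i) ⟩
    ψ ⟨$⟩ʳ rank p (φ′ ⟨$⟩ˡ i) r         ≡⟨ ψ≈ψ′ (rank p (φ′ ⟨$⟩ˡ i) r) ⟩
    ψ′ ⟨$⟩ʳ rank p (φ′ ⟨$⟩ˡ i) r        ≡⟨ rank-act p φ′ ψ′ i r ⟨
    rank (actProfile p φ′ ψ′ idΩ) i r   ∎
    where open ≡-Reasoning

  actProfile-∘ : ∀ φ ψ φ′ ψ′ →
                 actProfile (actProfile p φ ψ idΩ) φ′ ψ′ idΩ ≡ actProfile p (φ ∘ₚ φ′) (ψ ∘ₚ ψ′) idΩ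
  actProfile-∘ φ ψ φ′ ψ′ = profile-ext λ i r → begin
    rank (actProfile (actProfile p φ ψ idΩ) φ′ ψ′ idΩ) i r   ≡⟨ rank-act (actProfile p φ ψ idΩ) φ′ ψ′ i r ⟩
    ψ′ ⟨$⟩ʳ rank (actProfile p φ ψ idΩ) (φ′ ⟨$⟩ˡ i) r        ≡⟨ cong (ψ′ ⟨$⟩ʳ_) (rank-act p φ ψ _ r) ⟩
    ψ′ ⟨$⟩ʳ (ψ ⟨$⟩ʳ rank p (φ ⟨$⟩ˡ (φ′ ⟨$⟩ˡ i)) r)           ≡⟨ rank-act p (φ ∘ₚ φ′) (ψ ∘ₚ ψ′) i r ⟨
    rank (actProfile p (φ ∘ₚ φ′) (ψ ∘ₚ ψ′) idΩ) i r          ∎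
    where open ≡-Reasoning

  actProfile-id : actProfile p Perm.id Perm.id idΩ ≡ p
  actProfile-id = profile-ext (rank-act p Perm.id Perm.id)

module _ {m} (R : BRel m) where

  aut-cong : ∀ σ σ′ → σ Perm.≈ σ′ → IsAut R σ → IsAut R σ′
  aut-cong σ σ′ σ≈σ′ σ-aut x y = trans (cong₂ R (sym (σ≈σ′ x)) (sym (σ≈σ′ y))) (σ-aut x y)

  aut-id : IsAut R Perm.id
  aut-id x y = refl

  aut-∘ : ∀ σ τ → IsAut R σ → IsAut R τ → IsAut R (σ ∘ₚ τ)
  aut-∘ σ τ σ-aut τ-aut x y = trans (τ-aut _ _) (σ-aut x y)

  aut-flip : ∀ σ → IsAut R σ → IsAut R (flip σ)
  aut-flip σ σ-aut x y = trans (sym (σ-aut _ _)) (cong₂ R (inverseʳ σ) (inverseʳ σ))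

  aut? : ∀ σ → Dec (IsAut R σ)
  aut? σ = FinP.all? λ x → FinP.all? λ y → R (σ ⟨$⟩ʳ x) (σ ⟨$⟩ʳ y) BoolP.≟ R x y

module Symmetries {n h} (R : BRel h) (Q : BRel n) where

  record Sym : Set where
    field
      voters           : Permutation′ h
      alternatives     : Permutation′ n
      voters-aut       : IsAut R voters
      alternatives-aut : IsAut Q alternatives
  open Sym public

  infixr 5 _⊙_
  infixl 7 _∙_
  infix  8 _⁻¹

  _⊙_ : Sym → Profile n h → Profile n h
  g ⊙ p = actProfile p (voters g) (alternatives g) idΩ

  ε : Sym
  ε = record { voters = Perm.id ; alternatives = Perm.id ; voters-aut = aut-id R ; alternatives-aut = aut-id Q }

  -- g ∙ g′ acts as g′ followed by g.
  _∙_ : Sym → Sym → Sym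
  g ∙ g′ = record
    { voters           = voters g′ ∘ₚ voters g
    ; alternatives     = alternatives g′ ∘ₚ alternatives g
    ; voters-aut       = aut-∘ R (voters g′) (voters g) (voters-aut g′) (voters-aut g)
    ; alternatives-aut = aut-∘ Q (alternatives g′) (alternatives g) (alternatives-aut g′) (alternatives-aut g)
    }

  _⁻¹ : Sym → Sym
  g ⁻¹ = record
    { voters           = flip (voters g)
    ; alternatives     = flip (alternatives g)
    ; voters-aut       = aut-flip R (voters g) (voters-aut g)
    ; alternatives-aut = aut-flip Q (alternatives g) (alternatives-aut g)
    }

  ⊙-ε : ∀ p → ε ⊙ p ≡ p
  ⊙-ε = actProfile-id

  ⊙-∙ : ∀ g g′ p → (g ∙ g′) ⊙ p ≡ g ⊙ (g′ ⊙ p)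
  ⊙-∙ g g′ p = sym (actProfile-∘ p (voters g′) (alternatives g′) (voters g) (alternatives g))

  ⊙-⁻¹ : ∀ g p → g ⁻¹ ⊙ (g ⊙ p) ≡ p
  ⊙-⁻¹ g p = begin
    g ⁻¹ ⊙ (g ⊙ p)       ≡⟨ ⊙-∙ (g ⁻¹) g p ⟨
    (g ⁻¹ ∙ g) ⊙ p       ≡⟨ actProfile-cong p (voters (g ⁻¹ ∙ g)) Perm.id (alternatives (g ⁻¹ ∙ g)) Perm.id
                                 (λ _ → inverseˡ (voters g)) (λ _ → inverseˡ (alternatives g)) ⟩
    ε ⊙ p                ≡⟨ ⊙-ε p ⟩
    p                    ∎
    where open ≡-Reasoning

  _∼_ : Profile n h → Profile n h → Set
  p ∼ q = ∃ λ g → g ⊙ p ≡ q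

  ∼-refl : ∀ {p} → p ∼ p
  ∼-refl {p} = ε , ⊙-ε p

  ∼-sym : ∀ {p q} → p ∼ q → q ∼ p
  ∼-sym {p} (g , refl) = g ⁻¹ , ⊙-⁻¹ g p

  ∼-trans : ∀ {p q r} → p ∼ q → q ∼ r → p ∼ r
  ∼-trans {p} (g , refl) (g′ , refl) = g′ ∙ g , ⊙-∙ g′ g p

  -- Being in the same orbit is decidable: it suffices to try the finitely
  -- many pairs of permutations, as the action only depends on their values.
  _∼?_ : ∀ p q → Dec (p ∼ q)
  p ∼? q = map′ found exhibit (Any.any? witness? candidates)
    where
    candidates : List (Permutation′ h × Permutation′ n)
    candidates = cartesianProduct (permutations h) (permutations n)

    Witness : Permutation′ h × Permutation′ n → Set
    Witness (φ , ψ) = IsAut R φ × IsAut Q ψ × actProfile p φ ψ idΩ ≡ q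

    witness? : ∀ c → Dec (Witness c)
    witness? (φ , ψ) = aut? R φ ×-dec aut? Q ψ ×-dec (actProfile p φ ψ idΩ ≟P q)

    found : Any Witness candidates → p ∼ q
    found hit with (φ , ψ) , φ-aut , ψ-aut , moves ← Any.satisfied hit =
      record { voters = φ ; alternatives = ψ ; voters-aut = φ-aut ; alternatives-aut = ψ-aut } , moves

    exhibit : p ∼ q → Any Witness candidates
    exhibit (g , moves) with φ , φ∈ , g≈φ ← ∈-permutations (voters g)
                           | ψ , ψ∈ , g≈ψ ← ∈-permutations (alternatives g) =
      lose (∈-cartesianProduct⁺ φ∈ ψ∈)
           (aut-cong R (voters g) φ g≈φ (voters-aut g) , aut-cong Q (alternatives g) ψ g≈ψ (alternatives-aut g) ,
            trans (sym (actProfile-cong p (voters g) φ (alternatives g) ψ g≈φ g≈ψ)) moves)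

  rep : Profile n h → Profile n h
  rep p = first (p ∼?_) (profiles n h) (lose (∈-profiles p) ∼-refl)

  rep-related : ∀ p → p ∼ rep p
  rep-related p = first-satisfies (p ∼?_) (profiles n h) (lose (∈-profiles p) ∼-refl)

  rep-invariant : ∀ {p p′} → p ∼ p′ → rep p ≡ rep p′
  rep-invariant {p} {p′} p∼p′ = first-cong (p ∼?_) (p′ ∼?_)
    (λ q → mk⇔ (∼-trans {p′} {p} {q} (∼-sym {p} {p′} p∼p′)) (∼-trans {p} {p′} {q} p∼p′)) (profiles n h) _ _

  normaliser : Profile n h → Sym
  normaliser p = proj₁ (rep-related p)

  normaliser-⊙ : ∀ p → normaliser p ⊙ p ≡ rep p
  normaliser-⊙ p = proj₂ (rep-related p)

module Freeness {n h} (R : BRel h) (R-order : IsOrder R) (Q : BRel n)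
  (gcd≡1 : gcdList (distinctClassSizes R) ≡ 1) where

  open Symmetries R Q

  stabiliser-trivial : ∀ g p → g ⊙ p ≡ p → ∀ x → alternatives g ⟨$⟩ʳ x ≡ x
  stabiliser-trivial g p fixes = Regularity.trivial R R-order φ (voters-aut g) ψ
    (rank p) (λ j → linOrd-onto (lookup p j)) equivariant gcd≡1
    where
    φ = voters g
    ψ = alternatives g
    equivariant : ∀ j r → rank p (φ ⟨$⟩ʳ j) r ≡ ψ ⟨$⟩ʳ rank p j r
    equivariant j r = begin
      rank p (φ ⟨$⟩ʳ j) r                  ≡⟨ cong (λ q → rank q (φ ⟨$⟩ʳ j) r) fixes ⟨
      rank (g ⊙ p) (φ ⟨$⟩ʳ j) r            ≡⟨ rank-act p φ ψ (φ ⟨$⟩ʳ j) r ⟩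
      ψ ⟨$⟩ʳ rank p (φ ⟨$⟩ˡ (φ ⟨$⟩ʳ j)) r  ≡⟨ cong (λ i → ψ ⟨$⟩ʳ rank p i r) (inverseˡ φ) ⟩
      ψ ⟨$⟩ʳ rank p j r                    ∎
      where open ≡-Reasoning

  alternatives-determined : ∀ g g′ p → g ⊙ p ≡ g′ ⊙ p → alternatives g Perm.≈ alternatives g′
  alternatives-determined g g′ p same x =
    trans (sym (inverseʳ (alternatives g′))) (cong (alternatives g′ ⟨$⟩ʳ_) (stabiliser-trivial (g′ ⁻¹ ∙ g) p fixes x))
    where
    open ≡-Reasoning
    fixes : (g′ ⁻¹ ∙ g) ⊙ p ≡ p
    fixes = begin
      (g′ ⁻¹ ∙ g) ⊙ p   ≡⟨ ⊙-∙ (g′ ⁻¹) g p ⟩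
      g′ ⁻¹ ⊙ (g ⊙ p)   ≡⟨ cong (g′ ⁻¹ ⊙_) same ⟩
      g′ ⁻¹ ⊙ (g′ ⊙ p)  ≡⟨ ⊙-⁻¹ g′ p ⟩
      p                 ∎

record Action (n : ℕ) (A : Set) (Img : Permutation′ n → A → A → Set) : Set where
  field
    _≟_      : DecidableEquality A
    act      : Permutation′ n → A → A
    Img⇔     : ∀ {ψ a b} → Img ψ a b ⇔ (b ≡ act ψ a)
    act-id   : ∀ a → act Perm.id a ≡ a
    act-∘    : ∀ σ τ a → act τ (act σ a) ≡ act (σ ∘ₚ τ) a
    act-cong : ∀ σ σ′ a → σ Perm.≈ σ′ → act σ a ≡ act σ′ a

  act-inverse : ∀ σ a → act (flip σ) (act σ a) ≡ a
  act-inverse σ a = trans (act-∘ σ (flip σ) a) (trans (act-cong _ Perm.id a (λ _ → inverseˡ σ)) (act-id a))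

module Refinement {n h} (R : BRel h) (R-order : IsOrder R) (Q : BRel n)
  (gcd≡1 : gcdList (distinctClassSizes R) ≡ 1)
  {A : Set} {Img : Permutation′ n → A → A → Set} (α : Action n A Img) where

  open Action α
  open Generic n h A Img
  open Symmetries R Q
  open Freeness R R-order Q gcd≡1

  -- A consistent correspondence can be pulled back along any symmetry,
  -- splitting it into a change of voters and a change of alternatives.
  pull-back : ∀ (C : Corr) → Anonymous R C → Neutral Q C →
              ∀ g p b → T (C (g ⊙ p) b) → T (C p (act (flip (alternatives g)) b))
  pull-back C anonymous neutral g p b b∈ = subst (T ∘ C p) (sym a₀≡) a₀∈
    where
    φ = voters g
    ψ = alternatives g
    p₁ = actProfile p φ Perm.id idΩ
    split : actProfile p₁ Perm.id ψ idΩ ≡ g ⊙ p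
    split = trans (actProfile-∘ p φ Perm.id Perm.id ψ) (actProfile-cong p (φ ∘ₚ Perm.id) φ (Perm.id ∘ₚ ψ) ψ (λ _ → refl) (λ _ → refl))
    step₂ = Equivalence.to (neutral p₁ Perm.id ψ idΩ ((λ _ → refl) , alternatives-aut g , refl) b)
              (subst (λ q → T (C q b)) (sym split) b∈)
    a₁ = proj₁ step₂
    step₁ = Equivalence.to (anonymous p φ Perm.id idΩ (voters-aut g , (λ _ → refl) , refl) a₁) (proj₁ (proj₂ step₂))
    a₀ = proj₁ step₁
    a₀∈ = proj₁ (proj₂ step₁)
    a₀≡ : act (flip ψ) b ≡ a₀
    a₀≡ = begin
      act (flip ψ) b                       ≡⟨ cong (act (flip ψ)) (Equivalence.to Img⇔ (proj₂ (proj₂ step₂))) ⟩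
      act (flip ψ) (act ψ a₁)              ≡⟨ act-inverse ψ a₁ ⟩
      a₁                                   ≡⟨ Equivalence.to Img⇔ (proj₂ (proj₂ step₁)) ⟩
      act Perm.id a₀                       ≡⟨ act-id a₀ ⟩
      a₀                                   ∎
      where open ≡-Reasoning

  module Construction (C : Corr) (decisive : Decisive C) (anonymous : Anonymous R C) (neutral : Neutral Q C) where

    chosen : Profile n h → A
    chosen p₀ = proj₁ (decisive p₀)

    target : Profile n h → A
    target p = act (flip (alternatives (normaliser p))) (chosen (rep p))

    target-equivariant : ∀ g p → target (g ⊙ p) ≡ act (alternatives g) (target p)
    target-equivariant g p = begin
      act (flip ψ′) (chosen (rep (g ⊙ p)))  ≡⟨ cong (act (flip ψ′) ∘ chosen) (sym same-rep) ⟩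
      act (flip ψ′) (chosen (rep p))        ≡⟨ act-cong (flip ψ′) (flip ψ ∘ₚ alternatives g) _ flip-ψ′ ⟩
      act (flip ψ ∘ₚ alternatives g) (chosen (rep p)) ≡⟨ act-∘ (flip ψ) (alternatives g) _ ⟨
      act (alternatives g) (target p)       ∎
      where
      open ≡-Reasoning
      ψ  = alternatives (normaliser p)
      ψ′ = alternatives (normaliser (g ⊙ p))
      same-rep : rep p ≡ rep (g ⊙ p)
      same-rep = rep-invariant (g , refl)
      same-image : (normaliser (g ⊙ p) ∙ g) ⊙ p ≡ normaliser p ⊙ p
      same-image = begin
        (normaliser (g ⊙ p) ∙ g) ⊙ p  ≡⟨ ⊙-∙ (normaliser (g ⊙ p)) g p ⟩
        normaliser (g ⊙ p) ⊙ g ⊙ p    ≡⟨ normaliser-⊙ (g ⊙ p) ⟩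
        rep (g ⊙ p)                   ≡⟨ same-rep ⟨
        rep p                         ≡⟨ normaliser-⊙ p ⟨
        normaliser p ⊙ p              ∎
      flip-ψ′ : flip ψ′ Perm.≈ (flip ψ ∘ₚ alternatives g)
      flip-ψ′ = inverse-of-composite ψ′ (alternatives g) ψ
        (alternatives-determined (normaliser (g ⊙ p) ∙ g) (normaliser p) p same-image)

    C′ : Corr
    C′ p b = does (b ≟ target p)

    ∈C′⁻ : ∀ {p b} → T (C′ p b) → b ≡ target p
    ∈C′⁻ {p} {b} b∈ = does-true (b ≟ target p) (T⇒≡ b∈)

    ∈C′⁺ : ∀ {p b} → b ≡ target p → T (C′ p b)
    ∈C′⁺ {p} {b} b≡ = ≡⇒T (dec-true (b ≟ target p) b≡)

    resolute : Resolute C′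
    resolute p = target p , ∈C′⁺ refl , λ b b∈ → ∈C′⁻ b∈

    refines : Refines C′ C
    refines p b b∈ = subst (T ∘ C p) (sym (∈C′⁻ b∈))
      (pull-back C anonymous neutral (normaliser p) p _
        (subst (λ q → T (C q (chosen (rep p)))) (sym (normaliser-⊙ p)) (proj₂ (decisive (rep p)))))

    C′-image : ∀ g p → IsImage (alternatives g) (C′ p) (C′ (g ⊙ p))
    C′-image g p b = mk⇔
      (λ b∈ → target p , ∈C′⁺ refl , Equivalence.from Img⇔ (trans (∈C′⁻ b∈) (target-equivariant g p)))
      (λ { (a , a∈ , img) → ∈C′⁺ (trans (Equivalence.to Img⇔ img)
                               (trans (cong (act (alternatives g)) (∈C′⁻ a∈)) (sym (target-equivariant g p)))) })

    anonymous′ : Anonymous R C′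
    anonymous′ p φ ψ _ (φ-aut , ψ-id , refl) = C′-image (record
      { voters = φ ; alternatives = ψ ; voters-aut = φ-aut
      ; alternatives-aut = aut-cong Q Perm.id ψ (λ x → sym (ψ-id x)) (aut-id Q) }) p

    neutral′ : Neutral Q C′
    neutral′ p φ ψ _ (φ-id , ψ-aut , refl) = C′-image (record
      { voters = φ ; alternatives = ψ ; alternatives-aut = ψ-aut
      ; voters-aut = aut-cong R Perm.id φ (λ x → sym (φ-id x)) (aut-id R) }) p

  admits : AdmitsResoluteRefinements R Q
  admits C decisive anonymous neutral = C′ , resolute , refines , anonymous′ , neutral′
    where open Construction C decisive anonymous neutral

linOrdAction : ∀ n → Action n (LinOrd n) ImgLin
linOrdAction n = record
  { _≟_      = _≟L_
  ; act      = act
  ; Img⇔     = mk⇔ id id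
  ; act-id   = λ q → LinOrd-≡ (vec-ext (lookup-act Perm.id q))
  ; act-∘    = λ σ τ q → LinOrd-≡ (vec-ext λ r →
                 trans (lookup-act τ (act σ q) r) (trans (cong (τ ⟨$⟩ʳ_) (lookup-act σ q r)) (sym (lookup-act (σ ∘ₚ τ) q r))))
  ; act-cong = λ σ σ′ q σ≈σ′ → LinOrd-≡ (vec-ext λ r →
                 trans (lookup-act σ q r) (trans (σ≈σ′ _) (sym (lookup-act σ′ q r))))
  }
  where
  act : Permutation′ n → LinOrd n → LinOrd n
  act ψ q = actLin ψ q idΩ
  lookup-act : ∀ ψ q r → lookup (vec (act ψ q)) r ≡ ψ ⟨$⟩ʳ lookup (vec q) r
  lookup-act ψ q r = lookup∘tabulate _ r

module _ (n k : ℕ) where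

  KSubset-≡ : ∀ {W W′ : KSubset n k} → set W ≡ set W′ → W ≡ W′
  KSubset-≡ refl = refl

  image : Permutation′ n → Subset n → Subset n
  image ψ s = tabulate (λ x → lookup s (ψ ⟨$⟩ˡ x))

  ∣image∣ : ∀ ψ s → ∣ image ψ s ∣ ≡ ∣ s ∣
  ∣image∣ ψ s = trans (∣tabulate∘π∣ (flip ψ) (lookup s)) (cong ∣_∣ (tabulate∘lookup s))

  ∈-image : ∀ ψ s x → x ∈ image ψ s ⇔ (∃ λ y → y ∈ s × ψ ⟨$⟩ʳ y ≡ x)
  ∈-image ψ s x = mk⇔
    (λ x∈ → ψ ⟨$⟩ˡ x , lookup⇒[]= _ s (∈-tabulate⁻ x∈) , inverseʳ ψ)
    (λ { (y , y∈ , ψy≡x) → ∈-tabulate⁺ (trans (cong (lookup s) (trans (cong (ψ ⟨$⟩ˡ_) (sym ψy≡x)) (inverseˡ ψ)))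
                                                ([]=⇒lookup y∈)) })

  kSubsetAction : Action n (KSubset n k) ImgKSub
  kSubsetAction = record
    { _≟_      = λ W W′ → map′ KSubset-≡ (cong set) (VecP.≡-dec BoolP._≟_ (set W) (set W′))
    ; act      = act
    ; Img⇔     = λ {ψ} {W} {W′} → mk⇔
        (λ img → KSubset-≡ (⊆-antisym (λ x∈ → Equivalence.from (∈-image ψ (set W) _) (Equivalence.to (img _) x∈))
                                      (λ x∈ → Equivalence.from (img _) (Equivalence.to (∈-image ψ (set W) _) x∈))))
        (λ { refl x → ∈-image ψ (set W) x })
    ; act-id   = λ W → KSubset-≡ (trans (tabulate-cong (λ _ → refl)) (tabulate∘lookup (set W)))
    ; act-∘    = λ σ τ W → KSubset-≡ (tabulate-cong λ x → lookup∘tabulate _ (τ ⟨$⟩ˡ x))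
    ; act-cong = λ σ σ′ W σ≈σ′ → KSubset-≡ (tabulate-cong λ x → cong (lookup (set W)) (≈-inverse {π = σ} {σ′} σ≈σ′ x))
    }
    where
    act : Permutation′ n → KSubset n k → KSubset n k
    act ψ (mkKSub s s-card) = mkKSub (image ψ s) (trans (∣image∣ ψ s) s-card)

proposition25 : (n h : ℕ) → 2 ≤ n → 2 ≤ h →
    (R : BRel h) → IsOrder R → (Q : BRel n) → IsOrder Q →
    gcdList (distinctClassSizes R) ≡ 1 →
    SPC.AdmitsResoluteRefinements n h R Q ×
    ((k : ℕ) → 1 ≤ k → k < n → MW.AdmitsResoluteRefinements n h k R Q)
proposition25 n h _ _ R R-order Q _ gcd≡1 =
  Refinement.admits R R-order Q gcd≡1 (linOrdAction n) ,
  λ k _ _ → Refinement.admits R R-order Q gcd≡1 (kSubsetAction n k)
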